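{- Let $q$ and $t$ be positive integers and let $\mathcal{F}=\{A_1,\ldots,A_m\}$ be a family of pairwise disjoint finite sets such that $t-1\leqslant|A_1|\leqslant\cdots\leqslant|A_m|=t$. If $|\mathcal{F}|\geqslant 2(q+1)^{t+1}/q^t$, then Waiter has a winning strategy for the $(1:q)$ Client-Waiter game $\left(\bigcup_{i=1}^m A_i,\mathcal{F}^*\right)$; that is, Waiter can ensure that he claims all elements of some $A_i$.
   Context: $\mathcal{F}^*=\{B\subseteq\bigcup_i A_i : B\cap A_i\neq\emptyset\text{ for all } i\}$ is the transversal of $\mathcal{F}$. In the $(1:q)$ Client-Waiter game $(X,\mathcal{G})$, in each round Waiter offers Client at least $1$ and at most $q+1$ previously unclaimed elements of $X$; Client claims one of them and Waiter claims the rest; the game ends when all elements are claimed; Client wins iff he has claimed all elements of some member of $\mathcal{G}$, otherwise Waiter wins. -}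

module Defs where

open import Data.Nat using (ℕ; suc; _≤_)
open import Data.Fin using (Fin)
open import Data.Fin.Subset
open import Data.List using (List)
import Data.List as List
open import Data.Product using (Σ; ∃; _×_)
open import Relation.Nullary using (¬_)

bigUnion : ∀ {n m} → (Fin m → Subset n) → Subset n
bigUnion A = ⋃ (List.tabulate A)

Transversal : ∀ {n m} → (Fin m → Subset n) → Subset n → Set
Transversal A B = B ⊆ bigUnion A × (∀ i → Nonempty (B ∩ A i))

ClientHasWon : ∀ {n} → (Subset n → Set) → Subset n → Set
ClientHasWon G C = ∃ λ B → G B × B ⊆ C

-- Waiter has a winning strategy in the (1:q) Client-Waiter game with
-- winning family G, from the position where U is the set of unclaimed
-- elements and C is the set of Client's elements.
data WaiterWins (q : ℕ) {n : ℕ} (G : Subset n → Set) : Subset n → Subset n → Set where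
  finish : ∀ {U C} → Empty U → ¬ ClientHasWon G C → WaiterWins q G U C
  offer  : ∀ {U C} (O : Subset n) → O ⊆ U → 1 ≤ ∣ O ∣ → ∣ O ∣ ≤ suc q →
           (∀ {x} → x ∈ O → WaiterWins q G (U ─ O) (C ∪ ⁅ x ⁆)) →
           WaiterWins q G U C

WaiterHasWinningStrategy : ℕ → ∀ {n} → Subset n → (Subset n → Set) → Set
WaiterHasWinningStrategy q X G = WaiterWins q G X ⊥

-- Waiter keeps a queue of sets that Client has not touched.  In each round he
-- offers one unclaimed element from each of the next q + 1 queued sets; since
-- the sets are disjoint, Client's choice touches at most one of them, and each
-- of the others loses an element to Waiter.  A pass through the queue thus
-- lowers the number of unclaimed elements per surviving set by one while
-- keeping about a q/(q+1) fraction of the sets, so after t passes roughly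
-- m (q/(q+1))^t sets survive, which the hypothesis makes at least 2(q + 1).
-- A surviving set has been claimed entirely by Waiter, so Client never meets it.
module Submission where

open import Defs
open import Data.Nat using (ℕ; zero; suc; _≤_; _<_; _*_; _^_; _∸_; _+_; _⊔_; NonZero; z≤n; s≤s)
open import Data.Fin using (Fin; fromℕ) renaming (_≤_ to _≤ᶠ_)
open import Data.Fin.Subset
  using (Subset; ∣_∣; _∩_; _∪_; _─_; _-_; ⁅_⁆; _∈_; _∉_; _⊆_; Empty; Nonempty; inside; outside)
  renaming (⊥ to ∅)
open import Relation.Binary.PropositionalEquality using (_≡_; _≢_)
open import Data.Nat.Properties
open import Data.Nat.Tactic.RingSolver using (solve-∀)
open import Data.Bool.Properties using (∧-zeroʳ)
open import Data.Fin.Properties using (≤fromℕ)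
open import Data.Fin.Subset.Properties
open import Data.Vec using ([]; _∷_)
open import Data.List using (List; []; _∷_; _++_; length; filter; take; drop; allFin)
open import Data.List.Properties
  using (length-++; length-filter; filter-all; filter-++; ++-assoc; ++-identityʳ; length-take; length-drop;
         take++drop≡id; length-tabulate)
open import Data.List.Relation.Unary.All as All using (All; []; _∷_; lookupAny; all?)
open import Data.List.Relation.Unary.All.Properties
  using (++⁺; ++⁻ˡ; ++⁻ʳ; ¬All⇒Any¬; all-filter; tabulate⁺)
  renaming (filter⁺ to All-filter⁺)
open import Data.List.Relation.Unary.Any using (Any; here; there; satisfied)
open import Data.List.Relation.Unary.Unique.Propositional using (Unique)
open import Data.List.Relation.Unary.Unique.Propositional.Properties using (allFin⁺)
  renaming (filter⁺ to Unique-filter⁺)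
open import Data.List.Relation.Unary.AllPairs using ([]; _∷_)
open import Data.Product using (_×_; _,_; proj₁; proj₂; uncurry)
import Data.Product as Product
import Data.Sum as Sum
open import Data.Sum using (_⊎_; inj₁; inj₂)
open import Function using (_∘_)
open import Relation.Nullary using (¬_; Dec; yes; no; ¬?; contradiction)
open import Relation.Unary using (Decidable)
open import Relation.Binary.PropositionalEquality using (refl; sym; trans; cong; cong₂; subst; subst₂; module ≡-Reasoning)

-- At level r there are a sets with at most r unclaimed elements, weighing
-- q + 1 each, and a queue of b sets with at most r + 1, weighing q each since
-- one in every q + 1 of them may be lost; the reserve q * q, and counting an
-- empty queue as a single set, pay for the last, partial batch.
module Weight (q : ℕ) where

  weight : ℕ → ℕ → ℕ
  weight a b = suc q * a + q * (q + (b ⊔ 1))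

  record Viable (r a b : ℕ) : Set where
    constructor viable
    field bound : q * suc q ^ suc r < weight a b * q ^ r

  viable-mono : ∀ {r a b a′ b′} → weight a b ≤ weight a′ b′ → Viable r a b → Viable r a′ b′
  viable-mono {r} le (viable v) = viable (<-≤-trans v (*-monoˡ-≤ (q ^ r) le))

  weight-mono : ∀ {a b a′ b′} → a ≤ a′ → a + b ≤ a′ + b′ → weight a b ≤ weight a′ b′
  weight-mono {a} {b} {a′} {b′} a≤a′ sum≤ = begin
    weight a b                       ≡⟨ regroup q a (b ⊔ 1) ⟩
    a + q * (q + (a + (b ⊔ 1)))      ≤⟨ +-mono-≤ a≤a′ (*-monoʳ-≤ q (+-monoʳ-≤ q total≤)) ⟩
    a′ + q * (q + (a′ + (b′ ⊔ 1)))   ≡⟨ sym (regroup q a′ (b′ ⊔ 1)) ⟩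
    weight a′ b′                     ∎
    where
    open ≤-Reasoning
    regroup : ∀ q a c → suc q * a + q * (q + c) ≡ a + q * (q + (a + c))
    regroup = solve-∀
    total≤ : a + (b ⊔ 1) ≤ a′ + (b′ ⊔ 1)
    total≤ = begin
      a + (b ⊔ 1)            ≡⟨ +-distribˡ-⊔ a b 1 ⟩
      (a + b) ⊔ (a + 1)      ≤⟨ ⊔-mono-≤ sum≤ (+-monoˡ-≤ 1 a≤a′) ⟩
      (a′ + b′) ⊔ (a′ + 1)   ≡⟨ sym (+-distribˡ-⊔ a′ b′ 1) ⟩
      a′ + (b′ ⊔ 1)          ∎

  weight-batch : ∀ {a s₀ b} → s₀ ≡ q ⊎ b ≡ 0 → weight a (suc s₀ + b) ≤ weight (a + s₀) b
  weight-batch {a} {_} {b} (inj₁ refl) = begin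
    weight a (suc q + b)                ≡⟨ cong (λ c → suc q * a + q * (q + c)) (cong suc (⊔-identityʳ (q + b))) ⟩
    suc q * a + q * (q + suc (q + b))   ≡⟨ full q a b ⟩
    suc q * (a + q) + q * (q + b)       ≤⟨ +-monoʳ-≤ (suc q * (a + q)) (*-monoʳ-≤ q (+-monoʳ-≤ q (m≤m⊔n b 1))) ⟩
    weight (a + q) b                    ∎
    where
    open ≤-Reasoning
    full : ∀ q a b → suc q * a + q * (q + suc (q + b)) ≡ suc q * (a + q) + q * (q + b)
    full = solve-∀
  weight-batch {a} {s₀} {_} (inj₂ refl) = begin
    weight a (suc s₀ + 0)                  ≡⟨ cong (λ c → suc q * a + q * (q + c)) (cong suc (trans (⊔-identityʳ (s₀ + 0)) (+-identityʳ s₀))) ⟩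
    suc q * a + q * (q + suc s₀)           ≤⟨ m≤m+n _ s₀ ⟩
    suc q * a + q * (q + suc s₀) + s₀      ≡⟨ last q a s₀ ⟩
    weight (a + s₀) 0                      ∎
    where
    open ≤-Reasoning
    last : ∀ q a s → suc q * a + q * (q + suc s) + s ≡ suc q * (a + s) + q * (q + 1)
    last = solve-∀

  viable-round : ∀ {r a s₀ b c b′} → s₀ ≡ q ⊎ b ≡ 0 → b′ ≤ b → a + (suc s₀ + b) ≤ suc (c + b′) →
                 Viable r a (suc s₀ + b) → Viable r c b′
  viable-round {r} {a} {s₀} {b} {c} {b′} full b′≤b survivors =
    viable-mono (≤-trans (weight-batch {a} {s₀} {b} full) (weight-mono moved total))
    where
    total : a + s₀ + b ≤ c + b′
    total = ≤-pred (subst (_≤ suc (c + b′)) (trans (+-suc a (s₀ + b)) (cong suc (sym (+-assoc a s₀ b)))) survivors)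
    moved : a + s₀ ≤ c
    moved = +-cancelʳ-≤ b (a + s₀) c (≤-trans total (+-monoʳ-≤ c b′≤b))

  viable-descend : ∀ {r a} → Viable (suc r) a 0 → Viable r 0 a
  viable-descend {r} {a} (viable v) = viable (<-≤-trans (*-cancelˡ-< (suc q) _ _ scaled) (*-monoˡ-≤ (q ^ r) lower))
    where
    scaled : suc q * (q * suc q ^ suc r) < suc q * ((q * (q + a)) * q ^ r)
    scaled = subst₂ _<_ (swap q (suc q ^ suc r)) (rescale q a (q ^ r)) v
      where
      swap : ∀ q x → q * (suc q * x) ≡ suc q * (q * x)
      swap = solve-∀
      rescale : ∀ q a y → (suc q * a + q * (q + 1)) * (q * y) ≡ suc q * ((q * (q + a)) * y)
      rescale = solve-∀
    lower : q * (q + a) ≤ weight 0 a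
    lower = ≤-trans (*-monoʳ-≤ q (+-monoʳ-≤ q (m≤m⊔n a 1))) (m≤n+m _ (suc q * 0))

  viable-initial : ∀ {r m} → 2 * suc q ^ suc (suc r) ≤ m * q ^ suc r → Viable r 0 m
  viable-initial {r} {m} hyp = viable (begin-strict
    q * X                   <⟨ *-monoˡ-< X (≤-trans (n<1+n q) (m≤m+n (suc q) _)) ⟩
    2 * suc q * X           ≡⟨ *-assoc 2 (suc q) X ⟩
    2 * suc q ^ suc (suc r) ≤⟨ hyp ⟩
    m * (q * q ^ r)         ≡⟨ sym (*-assoc m q (q ^ r)) ⟩
    m * q * q ^ r           ≤⟨ *-monoˡ-≤ (q ^ r) lower ⟩
    weight 0 m * q ^ r      ∎)
    where
    open ≤-Reasoning
    X = suc q ^ suc r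
    instance
      X-nonZero : NonZero X
      X-nonZero = m^n≢0 (suc q) (suc r)
    lower : m * q ≤ weight 0 m
    lower = ≤-trans (≤-reflexive (*-comm m q))
              (≤-trans (*-monoʳ-≤ q (≤-trans (m≤m⊔n m 1) (m≤n+m _ q))) (m≤n+m _ (suc q * 0)))

  ¬viable-empty : ∀ {r} → ¬ Viable r 0 0
  ¬viable-empty {r} (viable v) = <⇒≱ v (begin
    weight 0 0 * q ^ r     ≡⟨ eval q (q ^ r) ⟩
    q * (suc q * q ^ r)    ≤⟨ *-monoʳ-≤ q (*-monoʳ-≤ (suc q) (^-monoˡ-≤ r (n≤1+n q))) ⟩
    q * suc q ^ suc r      ∎)
    where
    open ≤-Reasoning
    eval : ∀ q y → (suc q * 0 + q * (q + 1)) * y ≡ q * (suc q * y)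
    eval = solve-∀

⁅x⁆⊆p : ∀ {n} {x : Fin n} {p : Subset n} → x ∈ p → ⁅ x ⁆ ⊆ p
⁅x⁆⊆p {x = x} {p} x∈p y∈⁅x⁆ = subst (_∈ p) (sym (x∈⁅y⁆⇒x≡y x y∈⁅x⁆)) x∈p

x∈p⇒1≤∣p∣ : ∀ {n} {x : Fin n} {p : Subset n} → x ∈ p → 1 ≤ ∣ p ∣
x∈p⇒1≤∣p∣ {x = x} x∈p = subst (_≤ _) (∣⁅x⁆∣≡1 x) (p⊆q⇒∣p∣≤∣q∣ (⁅x⁆⊆p x∈p))

∣p∪q∣≤∣p∣+∣q∣ : ∀ {n} (p q : Subset n) → ∣ p ∪ q ∣ ≤ ∣ p ∣ + ∣ q ∣
∣p∪q∣≤∣p∣+∣q∣ []            []            = z≤n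
∣p∪q∣≤∣p∣+∣q∣ (inside ∷ p)  (inside ∷ q)  = s≤s (≤-trans (∣p∪q∣≤∣p∣+∣q∣ p q) (+-monoʳ-≤ ∣ p ∣ (n≤1+n ∣ q ∣)))
∣p∪q∣≤∣p∣+∣q∣ (inside ∷ p)  (outside ∷ q) = s≤s (∣p∪q∣≤∣p∣+∣q∣ p q)
∣p∪q∣≤∣p∣+∣q∣ (outside ∷ p) (inside ∷ q)  = subst (suc ∣ p ∪ q ∣ ≤_) (sym (+-suc ∣ p ∣ ∣ q ∣)) (s≤s (∣p∪q∣≤∣p∣+∣q∣ p q))
∣p∪q∣≤∣p∣+∣q∣ (outside ∷ p) (outside ∷ q) = ∣p∪q∣≤∣p∣+∣q∣ p q

p∩[q─r]≡p∩q─r : ∀ {n} (p q r : Subset n) → p ∩ (q ─ r) ≡ p ∩ q ─ r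
p∩[q─r]≡p∩q─r []      []      []            = refl
p∩[q─r]≡p∩q─r (x ∷ p) (y ∷ q) (inside ∷ r)  = cong₂ _∷_ (∧-zeroʳ x) (p∩[q─r]≡p∩q─r p q r)
p∩[q─r]≡p∩q─r (x ∷ p) (y ∷ q) (outside ∷ r) = cong (_ ∷_) (p∩[q─r]≡p∩q─r p q r)

waiterWins-by-invariant : ∀ q {n} {G : Subset n → Set} (Safe : Subset n → Subset n → Set) →
  (∀ {U C} → Safe U C → ¬ ClientHasWon G C) →
  (∀ {U C y} → y ∈ U → Safe U C → Safe (U - y) (C ∪ ⁅ y ⁆)) →
  ∀ {U C} → Safe U C → WaiterWins q G U C
waiterWins-by-invariant q {G = G} Safe lost step {U} safe = go ∣ U ∣ ≤-refl safe
  where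
  go : ∀ k {U C} → ∣ U ∣ ≤ k → Safe U C → WaiterWins q G U C
  go k {U} size safe with nonempty? U
  ... | no empty = finish empty (lost safe)
  go zero    size safe | yes (y , y∈U) = contradiction size (<⇒≱ (x∈p⇒1≤∣p∣ y∈U))
  go (suc k) {U} {C} size safe | yes (y , y∈U) =
    offer ⁅ y ⁆ (⁅x⁆⊆p y∈U) (≤-reflexive (sym (∣⁅x⁆∣≡1 y))) (≤-trans (≤-reflexive (∣⁅x⁆∣≡1 y)) (s≤s z≤n))
      λ x∈⁅y⁆ → subst (λ x → WaiterWins q G (U - y) (C ∪ ⁅ x ⁆)) (sym (x∈⁅y⁆⇒x≡y y x∈⁅y⁆))
        (go k (≤-pred (≤-trans (x∈p⇒∣p-x∣<∣p∣ y∈U) size)) (step y∈U safe))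

module Representatives {n} {I : Set} (P : I → Subset n) where

  reps : ∀ {is} → All (Nonempty ∘ P) is → Subset n
  reps []             = ∅
  reps ((y , _) ∷ ne) = ⁅ y ⁆ ∪ reps ne

  reps-⊆ : ∀ {is} (ne : All (Nonempty ∘ P) is) {x} → x ∈ reps ne → Any (λ i → x ∈ P i) is
  reps-⊆ []              x∈ = contradiction x∈ ∉⊥
  reps-⊆ ((y , y∈) ∷ ne) x∈ with x∈p∪q⁻ ⁅ y ⁆ (reps ne) x∈
  ... | inj₁ x∈⁅y⁆  = here (subst (_∈ P _) (sym (x∈⁅y⁆⇒x≡y y x∈⁅y⁆)) y∈)
  ... | inj₂ x∈reps = there (reps-⊆ ne x∈reps)

  ∣reps∣≤length : ∀ {is} (ne : All (Nonempty ∘ P) is) → ∣ reps ne ∣ ≤ length is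
  ∣reps∣≤length []             = ≤-reflexive (∣⊥∣≡0 n)
  ∣reps∣≤length ((y , _) ∷ ne) = ≤-trans (∣p∪q∣≤∣p∣+∣q∣ ⁅ y ⁆ (reps ne))
    (subst (λ k → k + _ ≤ _) (sym (∣⁅x⁆∣≡1 y)) (s≤s (∣reps∣≤length ne)))

  reps-meets : ∀ {is} (ne : All (Nonempty ∘ P) is) → All (λ i → Nonempty (P i ∩ reps ne)) is
  reps-meets []              = []
  reps-meets ((y , y∈) ∷ ne) = (y , x∈p∩q⁺ (y∈ , p⊆p∪q (reps ne) (x∈⁅x⁆ y)))
    ∷ All.map (Product.map₂ λ z∈ → x∈p∩q⁺ (Product.map₂ (q⊆p∪q ⁅ y ⁆ (reps ne)) (x∈p∩q⁻ _ _ z∈))) (reps-meets ne)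

open Representatives using (reps; reps-⊆; ∣reps∣≤length; reps-meets)

take-full-or-drop-empty : ∀ {A : Set} k (xs : List A) → length (take k xs) ≡ k ⊎ drop k xs ≡ []
take-full-or-drop-empty zero    xs       = inj₁ refl
take-full-or-drop-empty (suc k) []       = inj₂ refl
take-full-or-drop-empty (suc k) (x ∷ xs) = Sum.map₁ (cong suc) (take-full-or-drop-empty k xs)

module Strategy (q : ℕ) {n m : ℕ} (A : Fin m → Subset n)
                (disjoint : ∀ i j → i ≢ j → Empty (A i ∩ A j)) where

  open Weight q

  G : Subset n → Set
  G = Transversal A

  Untouched : Subset n → Fin m → Set
  Untouched C i = Empty (A i ∩ C)

  unclaimed : Subset n → Fin m → Subset n
  unclaimed U i = A i ∩ U

  Live : ℕ → Subset n → Subset n → Fin m → Set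
  Live r U C i = Untouched C i × ∣ unclaimed U i ∣ ≤ r

  untouched⇒¬clientHasWon : ∀ {C i} → Untouched C i → ¬ ClientHasWon G C
  untouched⇒¬clientHasWon {C} {i} untouched (B , (_ , meets) , B⊆C) with meets i
  ... | z , z∈B∩Aᵢ with x∈p∩q⁻ B (A i) z∈B∩Aᵢ
  ... | z∈B , z∈Aᵢ = untouched (z , x∈p∩q⁺ (z∈Aᵢ , B⊆C z∈B))

  untouched-∪ : ∀ {C i x} → Untouched C i → x ∉ A i → Untouched (C ∪ ⁅ x ⁆) i
  untouched-∪ {C} {i} {x} untouched x∉Aᵢ (z , z∈) with x∈p∩q⁻ (A i) (C ∪ ⁅ x ⁆) z∈
  ... | z∈Aᵢ , z∈C∪x with x∈p∪q⁻ C ⁅ x ⁆ z∈C∪x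
  ... | inj₁ z∈C = untouched (z , x∈p∩q⁺ (z∈Aᵢ , z∈C))
  ... | inj₂ z∈⁅x⁆ = x∉Aᵢ (subst (_∈ A i) (x∈⁅y⁆⇒x≡y x z∈⁅x⁆) z∈Aᵢ)

  unclaimed-─ : ∀ U O i → ∣ unclaimed (U ─ O) i ∣ ≡ ∣ unclaimed U i ─ O ∣
  unclaimed-─ U O i = cong ∣_∣ (p∩[q─r]≡p∩q─r (A i) U O)

  exhausted⇒waiterWins : ∀ {U C i} → Untouched C i → Empty (unclaimed U i) → WaiterWins q G U C
  exhausted⇒waiterWins {i = i} untouched exhausted =
    waiterWins-by-invariant q (λ U C → Untouched C i × Empty (unclaimed U i))
      (untouched⇒¬clientHasWon ∘ proj₁) claimOutside (untouched , exhausted)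
    where
    claimOutside : ∀ {U C y} → y ∈ U → Untouched C i × Empty (unclaimed U i) →
                   Untouched (C ∪ ⁅ y ⁆) i × Empty (unclaimed (U - y) i)
    claimOutside {U} {y = y} y∈U (untouched , exhausted) =
      untouched-∪ untouched (λ y∈Aᵢ → exhausted (y , x∈p∩q⁺ (y∈Aᵢ , y∈U))) ,
      λ (z , z∈) → exhausted (z , p─q⊆p (unclaimed U i) ⁅ y ⁆ (subst (z ∈_) (p∩[q─r]≡p∩q─r (A i) U ⁅ y ⁆) z∈))

  live-─ : ∀ {r U C i} O x → x ∉ A i → Live r U C i → Live r (U ─ O) (C ∪ ⁅ x ⁆) i
  live-─ {U = U} {i = i} O x x∉Aᵢ (untouched , size) =
    untouched-∪ untouched x∉Aᵢ ,
    ≤-trans (≤-reflexive (unclaimed-─ U O i)) (≤-trans (∣p─q∣≤∣p∣ (unclaimed U i) O) size)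

  live-─-meets : ∀ {r U C i} O x → x ∉ A i → Live (suc r) U C i × Nonempty (unclaimed U i ∩ O) →
                 Live r (U ─ O) (C ∪ ⁅ x ⁆) i
  live-─-meets {U = U} {i = i} O x x∉Aᵢ ((untouched , size) , meets) =
    untouched-∪ untouched x∉Aᵢ ,
    ≤-pred (≤-trans (≤-reflexive (cong suc (unclaimed-─ U O i)))
                    (≤-trans (p∩q≢∅⇒∣p─q∣<∣p∣ (unclaimed U i) O meets) size))

  ∉A? : (x : Fin n) → Decidable (λ i → x ∉ A i)
  ∉A? x i = ¬? (x ∈? A i)

  keep : Fin n → List (Fin m) → List (Fin m)
  keep x = filter (∉A? x)

  keep-All : ∀ {Q R : Fin m → Set} x → (∀ {i} → x ∉ A i → Q i → R i) →
             ∀ {is} → All Q is → All R (keep x is)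
  keep-All x f {is} qs = All.zipWith (uncurry f) (all-filter (∉A? x) is , All-filter⁺ (∉A? x) qs)

  -- Disjointness: a claimed element lies in at most one set of the family.
  length≤suc-length-keep : ∀ x {is} → Unique is → length is ≤ suc (length (keep x is))
  length≤suc-length-keep x {[]}     []         = z≤n
  length≤suc-length-keep x {i ∷ is} (i≢is ∷ u) with x ∈? A i
  ... | yes x∈Aᵢ = s≤s (≤-reflexive (sym (cong length (filter-all (∉A? x)
                     (All.map (λ i≢j x∈Aⱼ → disjoint i _ i≢j (x , x∈p∩q⁺ (x∈Aᵢ , x∈Aⱼ))) i≢is)))))
  ... | no  _    = s≤s (length≤suc-length-keep x u)

  -- `cur` is the queue of the current pass, `next` the sets it has already
  -- passed on to the following one.
  record Position (r : ℕ) (U C : Subset n) (next cur : List (Fin m)) : Set where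
    constructor position
    field
      unique    : Unique (next ++ cur)
      nextLive  : All (Live r U C) next
      curLive   : All (Live (suc r) U C) cur
      viability : Viable r (length next) (length cur)

  descend : ∀ {r U C next} → Position (suc r) U C next [] → Position r U C [] next
  descend {next = next} (position u nextLive _ v) =
    position (subst Unique (++-identityʳ next) u) [] nextLive (viable-descend v)

  afterClaim : ∀ {r U C next c g rest} (ne : All (Nonempty ∘ unclaimed U) (c ∷ g)) →
          length g ≡ q ⊎ rest ≡ [] → Position r U C next (c ∷ g ++ rest) → ∀ x →
          Position r (U ─ reps (unclaimed U) ne) (C ∪ ⁅ x ⁆) (keep x next ++ keep x (c ∷ g)) (keep x rest)
  afterClaim {r} {U} {C} {next} {c} {g} {rest} ne full (position u nextLive curLive v) x =
    position unique′
      (++⁺ (keep-All x (live-─ O x) nextLive)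
           (keep-All x (live-─-meets O x) (All.zip (++⁻ˡ (c ∷ g) curLive , reps-meets (unclaimed U) ne))))
      (keep-All x (live-─ O x) (++⁻ʳ (c ∷ g) curLive))
      (viable-round (Sum.map₂ (cong length) full) (length-filter (∉A? x) rest) survivors
        (subst (λ k → Viable r (length next) (suc k)) (length-++ g) v))
    where
    O = reps (unclaimed U) ne
    regroup : keep x (next ++ (c ∷ g) ++ rest) ≡ (keep x next ++ keep x (c ∷ g)) ++ keep x rest
    regroup = begin
      keep x (next ++ (c ∷ g) ++ rest)                 ≡⟨ filter-++ (∉A? x) next _ ⟩
      keep x next ++ keep x ((c ∷ g) ++ rest)          ≡⟨ cong (keep x next ++_) (filter-++ (∉A? x) (c ∷ g) rest) ⟩
      keep x next ++ keep x (c ∷ g) ++ keep x rest     ≡⟨ sym (++-assoc (keep x next) _ _) ⟩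
      (keep x next ++ keep x (c ∷ g)) ++ keep x rest   ∎
      where open ≡-Reasoning
    unique′ : Unique ((keep x next ++ keep x (c ∷ g)) ++ keep x rest)
    unique′ = subst Unique regroup (Unique-filter⁺ (∉A? x) u)
    survivors : length next + (suc (length g) + length rest) ≤
                suc (length (keep x next ++ keep x (c ∷ g)) + length (keep x rest))
    survivors = subst₂ (λ k l → k ≤ suc l)
      (trans (length-++ next) (cong (length next +_) (length-++ (c ∷ g))))
      (trans (cong length regroup) (length-++ (keep x next ++ keep x (c ∷ g))))
      (length≤suc-length-keep x u)

  waiterWins : ∀ r k {U C} next cur → length cur ≤ k → Position r U C next cur → WaiterWins q G U C
  waiterWins zero    _ []      [] _ p = contradiction (Position.viability p) ¬viable-empty
  waiterWins zero    _ (i ∷ _) [] _ p with untouched , none ← All.head (Position.nextLive p) =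
    exhausted⇒waiterWins untouched λ (y , y∈) → <⇒≱ (x∈p⇒1≤∣p∣ y∈) none
  waiterWins (suc r) _ next    [] _ p = waiterWins r _ [] next ≤-refl (descend p)
  waiterWins r (suc k) {U} {C} next (c ∷ cs) (s≤s cs≤k) p =
    playBatch (all? (nonempty? ∘ unclaimed U) batch)
      (subst (Position r U C next) (cong (c ∷_) (sym (take++drop≡id q cs))) p)
    where
    batch = c ∷ take q cs
    rest = drop q cs
    playBatch : Dec (All (Nonempty ∘ unclaimed U) batch) → Position r U C next (batch ++ rest) →
                WaiterWins q G U C
    playBatch (no ¬ne) p with (untouched , _) , exhausted ←
      lookupAny (++⁻ˡ batch (Position.curLive p)) (¬All⇒Any¬ (nonempty? ∘ unclaimed U) batch ¬ne) =
      exhausted⇒waiterWins untouched exhausted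
    playBatch (yes ne) p = offer O O⊆U 1≤∣O∣ ∣O∣≤1+q λ {x} _ →
      waiterWins r k _ (keep x rest) (rest-fuel x) (afterClaim ne (take-full-or-drop-empty q cs) p x)
      where
      O = reps (unclaimed U) ne
      O⊆U : O ⊆ U
      O⊆U x∈O = proj₂ (x∈p∩q⁻ (A _) U (proj₂ (satisfied (reps-⊆ (unclaimed U) ne x∈O))))
      1≤∣O∣ : 1 ≤ ∣ O ∣
      1≤∣O∣ = x∈p⇒1≤∣p∣ (p∩q⊆q _ O (proj₂ (All.head (reps-meets (unclaimed U) ne))))
      ∣O∣≤1+q : ∣ O ∣ ≤ suc q
      ∣O∣≤1+q = ≤-trans (∣reps∣≤length (unclaimed U) ne)
        (s≤s (≤-trans (≤-reflexive (length-take q cs)) (m⊓n≤m q _)))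
      rest-fuel : ∀ x → length (keep x rest) ≤ k
      rest-fuel x = ≤-trans (length-filter (∉A? x) rest)
        (≤-trans (≤-reflexive (length-drop q cs)) (≤-trans (m∸n≤m _ q) cs≤k))

proposition3p5 : (q t : ℕ) → 1 ≤ q → 1 ≤ t →
    (n m' : ℕ) → (A : Fin (suc m') → Subset n) →
    (∀ i j → i ≢ j → Empty (A i ∩ A j)) →
    (∀ i → t ∸ 1 ≤ ∣ A i ∣) →
    (∀ i j → i ≤ᶠ j → ∣ A i ∣ ≤ ∣ A j ∣) →
    ∣ A (fromℕ m') ∣ ≡ t →
    2 * (q + 1) ^ (t + 1) ≤ suc m' * q ^ t →
    WaiterHasWinningStrategy q (bigUnion A) (Transversal A)
proposition3p5 q (suc r) _ _ n m' A disjoint _ sorted top hyp =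
  waiterWins r _ [] (allFin (suc m')) ≤-refl
    (position (allFin⁺ (suc m')) [] (tabulate⁺ initiallyLive) initiallyViable)
  where
  open Strategy q A disjoint
  open Weight q
  initiallyLive : ∀ i → Live (suc r) (bigUnion A) ∅ i
  initiallyLive i =
    (λ (z , z∈) → ∉⊥ (proj₂ (x∈p∩q⁻ (A i) ∅ z∈))) ,
    ≤-trans (∣p∩q∣≤∣p∣ (A i) _) (subst (∣ A i ∣ ≤_) top (sorted i (fromℕ m') (≤fromℕ i)))
  initiallyViable : Viable r 0 (length (allFin (suc m')))
  initiallyViable = subst (Viable r 0) (sym (length-tabulate (λ (i : Fin (suc m')) → i)))
    (viable-initial {r} {suc m'} (subst₂ (λ s e → 2 * s ^ e ≤ suc m' * q ^ suc r) (+-comm q 1) (+-comm (suc r) 1) hyp))
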